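{- Let $n$ be odd. Then $\phi$ is injective on the set of elements of $B_n/C_n$ of rank $(n+1)/2$. These are the elements with exactly one unmatched 1, on which $\phi$ turns this unique unmatched 1 into a 0, mapping to rank $(n-1)/2$.
   Context: $B_n/C_n$: binary words of length $n$ up to cyclic rotation; rank is the number of 1's. Lyndon rearrangement: order letters by $1\prec 0$; the Lyndon rearrangement of a word is its lexicographically smallest cyclic rotation. Parenthesization: regard the word cyclically; repeatedly take a 0 immediately followed cyclically (among not yet matched letters) by a 1, match them, and remove them, until no such 0 remains. The resulting matching does not depend on choices. For a word with more 1's than 0's, the unmatched letters are all 1's, and there are exactly (number of 1's) $-$ (number of 0's) of them. For $x$ with more 1's than 0's, $\phi(x)$ is the class of the word obtained from the Lyndon rearrangement of $x$ by changing its rightmost unmatched 1 into a 0. -}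

module Defs where

open import Data.Bool using (Bool; true; false; if_then_else_)
open import Data.Nat using (ℕ; zero; suc; _+_; _*_; _⊔_)
open import Data.List using (List; []; _∷_; _++_; [_]; length; map; foldr; upTo; zip; reverse)
open import Data.Maybe using (Maybe; just; nothing)
open import Data.Product using (_×_; _,_; ∃)
open import Relation.Binary.PropositionalEquality using (_≡_)

-- Binary words: lists of Bools, true = letter 1, false = letter 0.
Word : Set
Word = List Bool

rank : Word → ℕ
rank [] = 0
rank (true ∷ w) = suc (rank w)
rank (false ∷ w) = rank w

rot1 : Word → Word
rot1 [] = []
rot1 (a ∷ w) = w ++ [ a ]

rotate : ℕ → Word → Word
rotate zero w = w
rotate (suc k) w = rotate k (rot1 w)

-- equality in B_n/C_n: same class under cyclic rotation
_∼_ : Word → Word → Set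
x ∼ y = ∃ λ k → rotate k x ≡ y

-- lexicographic ≤ with letter order 1 ≺ 0 (true ≺ false)
lexLeq : Word → Word → Bool
lexLeq [] _ = true
lexLeq (_ ∷ _) [] = false
lexLeq (true ∷ a) (true ∷ b) = lexLeq a b
lexLeq (false ∷ a) (false ∷ b) = lexLeq a b
lexLeq (true ∷ _) (false ∷ _) = true
lexLeq (false ∷ _) (true ∷ _) = false

minL : Word → Word → Word
minL a b = if lexLeq a b then a else b

lyndon : Word → Word
lyndon x = foldr minL x (map (λ k → rotate k x) (upTo (length x)))

-- Parenthesization. Unmatched letters are kept as (position , letter),
-- in cyclic order starting from position 0.
Letters : Set
Letters = List (ℕ × Bool)

removeLin : Letters → Maybe Letters
removeLin ((i , false) ∷ (j , true) ∷ r) = just r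
removeLin (a ∷ b ∷ r) with removeLin (b ∷ r)
... | just r' = just (a ∷ r')
... | nothing = nothing
removeLin _ = nothing

removeWrap : Letters → Maybe Letters
removeWrap ((i , true) ∷ t) with reverse t
... | (j , false) ∷ rt = just (reverse rt)
... | _ = nothing
removeWrap _ = nothing

matchStep : Letters → Maybe Letters
matchStep l with removeLin l
... | just l' = just l'
... | nothing = removeWrap l

-- iterate until no 0 is cyclically followed by a 1 (fuel suffices:
-- each step removes two letters)
matchLoop : ℕ → Letters → Letters
matchLoop zero l = l
matchLoop (suc k) l with matchStep l
... | just l' = matchLoop k l'
... | nothing = l

indexed : Word → Letters
indexed x = zip (upTo (length x)) x

unmatched : Word → Letters
unmatched x = matchLoop (length x) (indexed x)

rightmostOne : Letters → Maybe ℕ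
rightmostOne [] = nothing
rightmostOne ((i , true) ∷ r) with rightmostOne r
... | just j = just (i ⊔ j)
... | nothing = just i
rightmostOne ((i , false) ∷ r) = rightmostOne r

setZero : ℕ → Word → Word
setZero _ [] = []
setZero zero (_ ∷ w) = false ∷ w
setZero (suc i) (a ∷ w) = a ∷ setZero i w

-- φ(x) (a representative of its class): Lyndon rearrangement of x with its
-- rightmost unmatched 1 changed to 0 (unchanged if there is none, which
-- does not happen when rank x exceeds the number of 0's)
φ : Word → Word
φ x with rightmostOne (unmatched (lyndon x))
... | just i = setZero i (lyndon x)
... | nothing = lyndon x

-- Read 0 as an opening and 1 as a closing bracket. Throughout the parenthesization, the
-- letters strictly between two cyclically consecutive unmatched letters form a Dyck word.
-- When there is one more 1 than 0 the process ends with a single unmatched 1, so the word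
-- is a rotation of 1D, and φ x a rotation of 0D, for one Dyck word D (only the fact that
-- the Lyndon rearrangement is a rotation is used). A word 0D with D Dyck has no other
-- rotation of that form, since two of them would split it into two suffixes each with at
-- least as many 1s as 0s. So the class of φ x determines D, and D the class of x.
module Submission where

open import Defs
open import Data.Bool using (Bool; true; false)
open import Data.Nat using (ℕ; zero; suc; _+_; _*_; _≤_; z≤n; s≤s⁻¹)
open import Data.Nat.Properties
  using (+-comm; +-suc; +-identityʳ; +-cancelˡ-≡; suc-injective; <-irrefl; +-mono-≤; ≤-reflexive; ≤-trans; n≤1+n)
open import Data.Nat.Tactic.RingSolver using (solve-∀)
open import Data.List using (List; []; _∷_; _++_; [_]; length; map; reverse; zip; applyUpTo; upTo; initLast; _∷ʳ′_)
open import Data.List.Properties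
  using (++-assoc; ++-identityʳ; length-++; map-++; length-map; map-∘; map-id; ∷-injectiveˡ; ∷-injectiveʳ;
         reverse-involutive; unfold-reverse; reverse-++; foldr-preservesᵇ)
open import Data.List.Relation.Unary.All using (All; []; _∷_; universal)
open import Data.List.Relation.Unary.All.Properties using (++⁺; ++⁻; map⁺)
open import Data.Maybe using (just; nothing)
open import Data.Maybe.Properties using (just-injective)
open import Data.Product using (_×_; _,_; proj₁; proj₂; ∃; ∃₂; uncurry)
open import Data.Empty using (⊥-elim)
open import Data.Unit using (⊤; tt)
open import Function using (_∘_; id)
open import Relation.Nullary using (¬_)
open import Relation.Binary.PropositionalEquality hiding ([_])
open ≡-Reasoning

rotate-rot1 : ∀ m w → rotate m (rot1 w) ≡ rot1 (rotate m w)
rotate-rot1 zero w = refl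
rotate-rot1 (suc m) w = rotate-rot1 m (rot1 w)

rotate-+ : ∀ m k w → rotate (m + k) w ≡ rotate k (rotate m w)
rotate-+ zero k w = refl
rotate-+ (suc m) k w = rotate-+ m k (rot1 w)

rotate-length-++ : ∀ u v → rotate (length u) (u ++ v) ≡ v ++ u
rotate-length-++ [] v = sym (++-identityʳ v)
rotate-length-++ (c ∷ u) v = begin
  rotate (length u) ((u ++ v) ++ [ c ]) ≡⟨ cong (rotate (length u)) (++-assoc u v [ c ]) ⟩
  rotate (length u) (u ++ v ++ [ c ])   ≡⟨ rotate-length-++ u (v ++ [ c ]) ⟩
  (v ++ [ c ]) ++ u                     ≡⟨ ++-assoc v [ c ] u ⟩
  v ++ c ∷ u                            ∎

rot1-factorisation : ∀ u v → ∃₂ λ u′ v′ → u ++ v ≡ u′ ++ v′ × rot1 (v ++ u) ≡ v′ ++ u′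
rot1-factorisation [] [] = [] , [] , refl , refl
rot1-factorisation (c ∷ u) [] = [ c ] , u , cong (c ∷_) (++-identityʳ u) , refl
rot1-factorisation u (c ∷ v) = u ++ [ c ] , v , sym (++-assoc u [ c ] v) , ++-assoc v u [ c ]

rotate-factorisation : ∀ m w → ∃₂ λ u v → w ≡ u ++ v × rotate m w ≡ v ++ u
rotate-factorisation zero w = [] , w , refl , sym (++-identityʳ w)
rotate-factorisation (suc m) w with rotate-factorisation m w
... | u , v , w≡ , rot≡ with rot1-factorisation u v
... | u′ , v′ , uv≡ , rot1≡ =
  u′ , v′ , trans w≡ uv≡ , trans (trans (rotate-rot1 m w) (cong rot1 rot≡)) rot1≡

++-∼ : ∀ (u v : Word) → (u ++ v) ∼ (v ++ u)
++-∼ u v = length u , rotate-length-++ u v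

∼-sym : ∀ {x y} → x ∼ y → y ∼ x
∼-sym {x} (m , refl) with rotate-factorisation m x
... | u , v , x≡ , rot≡ = subst₂ _∼_ (sym rot≡) (sym x≡) (++-∼ v u)

∼-trans : ∀ {x y z} → x ∼ y → y ∼ z → x ∼ z
∼-trans {x} (m , refl) (k , refl) = m + k , rotate-+ m k x

∼-additive : (f : Word → ℕ) → (∀ u v → f (u ++ v) ≡ f u + f v) → ∀ {x y} → x ∼ y → f y ≡ f x
∼-additive f f-++ {x} (m , refl) with rotate-factorisation m x
... | u , v , refl , rot≡ = begin
  f (rotate m (u ++ v)) ≡⟨ cong f rot≡ ⟩
  f (v ++ u)            ≡⟨ f-++ v u ⟩
  f v + f u             ≡⟨ +-comm (f v) (f u) ⟩
  f u + f v             ≡⟨ f-++ u v ⟨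
  f (u ++ v)            ∎

∼-lyndon : ∀ x → x ∼ lyndon x
∼-lyndon x = foldr-preservesᵇ {P = x ∼_} {f = minL} (minL-preserves (x ∼_)) (0 , refl)
  (map⁺ {P = x ∼_} (universal (λ k → k , refl) (upTo (length x))))
  where
  minL-preserves : (P : Word → Set) → ∀ {a b} → P a → P b → P (minL a b)
  minL-preserves P {a} {b} pa pb with lexLeq a b
  ... | true = pa
  ... | false = pb

zeros : Word → ℕ
zeros [] = 0
zeros (true ∷ w) = zeros w
zeros (false ∷ w) = suc (zeros w)

rank-++ : ∀ u v → rank (u ++ v) ≡ rank u + rank v
rank-++ [] v = refl
rank-++ (true ∷ u) v = cong suc (rank-++ u v)
rank-++ (false ∷ u) v = rank-++ u v

zeros-++ : ∀ u v → zeros (u ++ v) ≡ zeros u + zeros v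
zeros-++ [] v = refl
zeros-++ (true ∷ u) v = zeros-++ u v
zeros-++ (false ∷ u) v = cong suc (zeros-++ u v)

length≡rank+zeros : ∀ w → length w ≡ rank w + zeros w
length≡rank+zeros [] = refl
length≡rank+zeros (true ∷ w) = cong suc (length≡rank+zeros w)
length≡rank+zeros (false ∷ w) = trans (cong suc (length≡rank+zeros w)) (sym (+-suc (rank w) (zeros w)))

OnesDominate : Word → Set
OnesDominate w = zeros w ≤ rank w

onesDominate-++ : ∀ u v → OnesDominate u → OnesDominate v → OnesDominate (u ++ v)
onesDominate-++ u v du dv = subst₂ _≤_ (sym (zeros-++ u v)) (sym (rank-++ u v)) (+-mono-≤ du dv)

SuffixesDominate : Word → Set
SuffixesDominate [] = ⊤
SuffixesDominate (c ∷ w) = OnesDominate (c ∷ w) × SuffixesDominate w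

suffixesDominate-++ : ∀ u {v} → SuffixesDominate u → SuffixesDominate v → OnesDominate v →
                      SuffixesDominate (u ++ v)
suffixesDominate-++ [] _ sv _ = sv
suffixesDominate-++ (c ∷ u) (du , su) sv dv = onesDominate-++ (c ∷ u) _ du dv , suffixesDominate-++ u su sv dv

suffixesDominate-suffix : ∀ u {v} → SuffixesDominate (u ++ v) → OnesDominate v
suffixesDominate-suffix [] {[]} _ = z≤n
suffixesDominate-suffix [] {c ∷ v} (dv , _) = dv
suffixesDominate-suffix (c ∷ u) (_ , su) = suffixesDominate-suffix u su

-- A 0 is matched with a later 1, so a word is fully matched iff it is balanced and, read
-- from the right, 1s never fall behind 0s.
Dyck : Word → Set
Dyck w = zeros w ≡ rank w × SuffixesDominate w

Dyck-[] : Dyck []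
Dyck-[] = refl , tt

Dyck-++ : ∀ {u v} → Dyck u → Dyck v → Dyck (u ++ v)
Dyck-++ {u} {v} (bu , su) (bv , sv) =
  trans (zeros-++ u v) (trans (cong₂ _+_ bu bv) (sym (rank-++ u v))) ,
  suffixesDominate-++ u su sv (≤-reflexive bv)

Dyck-nest : ∀ {u} → Dyck u → Dyck (false ∷ u ++ [ true ])
Dyck-nest {u} (bu , su) = balanced , ≤-reflexive balanced , suffixesDominate-++ u su (z≤n , tt) z≤n
  where
  balanced : suc (zeros (u ++ [ true ])) ≡ rank (u ++ [ true ])
  balanced = begin
    suc (zeros (u ++ [ true ]))  ≡⟨ cong suc (trans (zeros-++ u [ true ]) (+-identityʳ (zeros u))) ⟩
    suc (zeros u)                ≡⟨ cong suc bu ⟩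
    suc (rank u)                 ≡⟨ +-comm 1 (rank u) ⟩
    rank u + 1                   ≡⟨ rank-++ u [ true ] ⟨
    rank (u ++ [ true ])         ∎

¬onesDominate-false∷Dyck : ∀ {D} → Dyck D → ¬ OnesDominate (false ∷ D)
¬onesDominate-false∷Dyck {D} (bD , _) dom = <-irrefl refl (subst (λ z → suc z ≤ rank D) bD dom)

false∷Dyck-∼-injective : ∀ {D D′} → Dyck D → Dyck D′ → (false ∷ D) ∼ (false ∷ D′) → D ≡ D′
false∷Dyck-∼-injective {D} dD dD′ (m , rot≡) with rotate-factorisation m (false ∷ D)
... | [] , v , w≡ , r≡ = ∷-injectiveʳ (trans w≡ (trans (sym (++-identityʳ v)) (trans (sym r≡) rot≡)))
... | u , [] , w≡ , r≡ = ∷-injectiveʳ (trans w≡ (trans (++-identityʳ u) (trans (sym r≡) rot≡)))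
... | c ∷ u , d ∷ v , w≡ , r≡ = ⊥-elim (¬onesDominate-false∷Dyck dD (subst OnesDominate (sym w≡) dom))
  where
  dom : OnesDominate ((c ∷ u) ++ (d ∷ v))
  dom = onesDominate-++ (c ∷ u) (d ∷ v)
    (suffixesDominate-suffix v (subst SuffixesDominate (∷-injectiveʳ (trans (sym rot≡) r≡)) (proj₂ dD′)))
    (suffixesDominate-suffix u (subst SuffixesDominate (∷-injectiveʳ w≡) (proj₂ dD)))

bits : Letters → Word
bits = map proj₂

rank-bits-++ : ∀ l l′ → rank (bits (l ++ l′)) ≡ rank (bits l) + rank (bits l′)
rank-bits-++ l l′ = trans (cong rank (map-++ proj₂ l l′)) (rank-++ (bits l) (bits l′))

zeros-bits-++ : ∀ l l′ → zeros (bits (l ++ l′)) ≡ zeros (bits l) + zeros (bits l′)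
zeros-bits-++ l l′ = trans (cong zeros (map-++ proj₂ l l′)) (zeros-++ (bits l) (bits l′))

data AdjacentRemoved (l l′ : Letters) : Set where
  adjacentRemoved : ∀ p i j r → l ≡ p ++ (i , false) ∷ (j , true) ∷ r → l′ ≡ p ++ r → AdjacentRemoved l l′

adjacentRemoved-∷ : ∀ a {l l′} → AdjacentRemoved l l′ → AdjacentRemoved (a ∷ l) (a ∷ l′)
adjacentRemoved-∷ a (adjacentRemoved p i j r refl refl) = adjacentRemoved (a ∷ p) i j r refl refl

removeLin-just : ∀ l {l′} → removeLin l ≡ just l′ → AdjacentRemoved l l′
removeLin-just ((i , false) ∷ (j , true) ∷ r) refl = adjacentRemoved [] i j r refl refl
removeLin-just ((i , false) ∷ (j , false) ∷ r) h
  with removeLin ((j , false) ∷ r) | removeLin-just ((j , false) ∷ r)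
... | just r′ | ih = subst (AdjacentRemoved _) (just-injective h) (adjacentRemoved-∷ (i , false) (ih refl))
removeLin-just ((i , true) ∷ b ∷ r) h with removeLin (b ∷ r) | removeLin-just (b ∷ r)
... | just r′ | ih = subst (AdjacentRemoved _) (just-injective h) (adjacentRemoved-∷ (i , true) (ih refl))

data MatchedStep (l l′ : Letters) : Set where
  adjacent  : AdjacentRemoved l l′ → MatchedStep l l′
  aroundEnd : ∀ i j → l ≡ (i , true) ∷ l′ ++ [ (j , false) ] → MatchedStep l l′

removeWrap-just : ∀ l {l′} → removeWrap l ≡ just l′ → ∃₂ λ i j → l ≡ (i , true) ∷ l′ ++ [ (j , false) ]
removeWrap-just ((i , true) ∷ t) h with reverse t in e
removeWrap-just ((i , true) ∷ t) refl | (j , false) ∷ rt = i , j , cong ((i , true) ∷_) (begin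
  t                            ≡⟨ reverse-involutive t ⟨
  reverse (reverse t)          ≡⟨ cong reverse e ⟩
  reverse ((j , false) ∷ rt)   ≡⟨ unfold-reverse (j , false) rt ⟩
  reverse rt ++ [ (j , false) ] ∎)

removeWrap-aroundEnd : ∀ i m j → removeWrap ((i , true) ∷ m ++ [ (j , false) ]) ≡ just m
removeWrap-aroundEnd i m j rewrite reverse-++ m [ (j , false) ] = cong just (reverse-involutive m)

matchStep-just : ∀ l {l′} → matchStep l ≡ just l′ → MatchedStep l l′
matchStep-just l h with removeLin l in e
... | just _ = adjacent (removeLin-just l (trans e h))
... | nothing with removeWrap-just l h
...   | i , j , l≡ = aroundEnd i j l≡

matchStep-nothing : ∀ l → matchStep l ≡ nothing → removeLin l ≡ nothing × removeWrap l ≡ nothing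
matchStep-nothing l h with removeLin l
... | nothing = refl , h

matchedStep-counts : ∀ {l l′} → MatchedStep l l′ →
  rank (bits l) ≡ suc (rank (bits l′)) × zeros (bits l) ≡ suc (zeros (bits l′))
matchedStep-counts (adjacent (adjacentRemoved p i j r refl refl)) =
  trans (rank-bits-++ p _) (trans (+-suc _ _) (cong suc (sym (rank-bits-++ p r)))) ,
  trans (zeros-bits-++ p _) (trans (+-suc _ _) (cong suc (sym (zeros-bits-++ p r))))
matchedStep-counts {l′ = m} (aroundEnd i j refl) =
  cong suc (trans (rank-bits-++ m _) (+-identityʳ _)) ,
  trans (zeros-bits-++ m _) (+-comm _ 1)

matchedStep-length : ∀ {l l′} → MatchedStep l l′ → length l ≡ suc (suc (length l′))
matchedStep-length {l} {l′} s with matchedStep-counts s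
... | rank≡ , zeros≡ = begin
  length l                                ≡⟨ length-bits l ⟩
  rank (bits l) + zeros (bits l)          ≡⟨ cong₂ _+_ rank≡ zeros≡ ⟩
  suc (rank (bits l′)) + suc (zeros (bits l′)) ≡⟨ cong suc (+-suc _ _) ⟩
  suc (suc (rank (bits l′) + zeros (bits l′))) ≡⟨ cong (suc ∘ suc) (length-bits l′) ⟨
  suc (suc (length l′))                   ∎
  where
  length-bits : ∀ l → length l ≡ rank (bits l) + zeros (bits l)
  length-bits l = trans (sym (length-map proj₂ l)) (length≡rank+zeros (bits l))

matchLoop-invariant : (P : Letters → Set) → (∀ {l l′} → MatchedStep l l′ → P l → P l′) →
  ∀ k l → length l ≤ k → P l → P (matchLoop k l) × matchStep (matchLoop k l) ≡ nothing
matchLoop-invariant P step zero [] z≤n p = p , refl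
matchLoop-invariant P step (suc k) l len p with matchStep l in e
... | nothing = p , e
... | just l′ = matchLoop-invariant P step k l′ len′ (step s p)
  where
  s = matchStep-just l e
  len′ : length l′ ≤ k
  len′ = ≤-trans (n≤1+n _) (s≤s⁻¹ (subst (_≤ suc k) (matchedStep-length s) len))

removeLin-nothing-∷ : ∀ a l → removeLin (a ∷ l) ≡ nothing → removeLin l ≡ nothing
removeLin-nothing-∷ a [] _ = refl
removeLin-nothing-∷ (i , false) ((j , false) ∷ r) h with removeLin ((j , false) ∷ r)
... | nothing = refl
removeLin-nothing-∷ (i , true) (b ∷ r) h with removeLin (b ∷ r)
... | nothing = refl

removeLin-nothing-false∷ : ∀ i r → removeLin ((i , false) ∷ r) ≡ nothing → rank (bits r) ≡ 0
removeLin-nothing-false∷ i [] _ = refl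
removeLin-nothing-false∷ i ((j , false) ∷ r) h =
  removeLin-nothing-false∷ j r (removeLin-nothing-∷ (i , false) ((j , false) ∷ r) h)

removeLin-nothing-∷ʳ-true : ∀ l j → removeLin (l ++ [ (j , true) ]) ≡ nothing → zeros (bits l) ≡ 0
removeLin-nothing-∷ʳ-true [] j _ = refl
removeLin-nothing-∷ʳ-true ((i , true) ∷ l) j h =
  removeLin-nothing-∷ʳ-true l j (removeLin-nothing-∷ (i , true) (l ++ [ (j , true) ]) h)
removeLin-nothing-∷ʳ-true ((i , false) ∷ l) j h
  with trans (sym (rank-bits-++ l [ (j , true) ])) (removeLin-nothing-false∷ i (l ++ [ (j , true) ]) h)
... | rank+1≡0 with trans (+-comm 1 (rank (bits l))) rank+1≡0
...   | ()

Excess : Letters → Set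
Excess l = rank (bits l) ≡ suc (zeros (bits l))

Excess-step : ∀ {l l′} → MatchedStep l l′ → Excess l → Excess l′
Excess-step s e with matchedStep-counts s
... | rank≡ , zeros≡ = suc-injective (trans (sym rank≡) (trans e (cong suc zeros≡)))

-- With no 0 followed by a 1, even cyclically, the letters are all 1s or all 0s; one more 1
-- than 0 leaves a single 1.
stuck-excess : ∀ l → removeLin l ≡ nothing → removeWrap l ≡ nothing → Excess l →
               ∃ λ i → l ≡ (i , true) ∷ []
stuck-excess ((i , false) ∷ r) lin _ ex with trans (sym (removeLin-nothing-false∷ i r lin)) ex
... | ()
stuck-excess ((i , true) ∷ r) lin wrap ex with initLast r
... | [] = i , refl
... | m ∷ʳ′ (j , false) with trans (sym (removeWrap-aroundEnd i m j)) wrap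
...   | ()
stuck-excess ((i , true) ∷ r) lin wrap ex | m ∷ʳ′ (j , true)
  with suc-injective (begin
    suc (suc (rank (bits m)))                ≡⟨ cong suc (+-comm 1 (rank (bits m))) ⟩
    suc (rank (bits m) + 1)                  ≡⟨ cong suc (rank-bits-++ m _) ⟨
    suc (rank (bits (m ++ [ (j , true) ])))  ≡⟨ ex ⟩
    suc (zeros (bits (m ++ [ (j , true) ]))) ≡⟨ cong suc (zeros-bits-++ m _) ⟩
    suc (zeros (bits m) + 0)                 ≡⟨ cong suc (+-identityʳ _) ⟩
    suc (zeros (bits m))                     ≡⟨ cong suc (removeLin-nothing-∷ʳ-true ((i , true) ∷ m) j lin) ⟩
    1                                        ∎)
... | ()

-- A block is a gap followed by an unmatched letter.
Block : Set
Block = Word × Bool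

flattenOnto : List Block → Word → Word
flattenOnto [] e = e
flattenOnto ((D , c) ∷ bs) e = D ++ c ∷ flattenOnto bs e

flatten : List Block → Word
flatten bs = flattenOnto bs []

flattenOnto-++ : ∀ bs cs e → flattenOnto (bs ++ cs) e ≡ flattenOnto bs (flattenOnto cs e)
flattenOnto-++ [] cs e = refl
flattenOnto-++ ((D , c) ∷ bs) cs e = cong (λ z → D ++ c ∷ z) (flattenOnto-++ bs cs e)

letters : ℕ → List Block → Letters
letters o [] = []
letters o ((D , c) ∷ bs) = (length D + o , c) ∷ letters (suc (length D + o)) bs

letters-offset : ∀ D c bs o → length (flatten bs) + suc (length D + o) ≡ length (flatten ((D , c) ∷ bs)) + o
letters-offset D c bs o = begin
  length (flatten bs) + suc (length D + o) ≡⟨ arith (length (flatten bs)) (length D) o ⟩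
  length D + suc (length (flatten bs)) + o ≡⟨ cong (_+ o) (length-++ D) ⟨
  length (flatten ((D , c) ∷ bs)) + o      ∎
  where
  arith : ∀ f d o → f + suc (d + o) ≡ d + suc f + o
  arith = solve-∀

letters-++ : ∀ o bs cs → letters o (bs ++ cs) ≡ letters o bs ++ letters (length (flatten bs) + o) cs
letters-++ o [] cs = refl
letters-++ o ((D , c) ∷ bs) cs = cong (_ ∷_) (trans (letters-++ _ bs cs)
  (cong (λ z → letters (suc (length D + o)) bs ++ letters z cs) (letters-offset D c bs o)))

letters-++⁻ : ∀ o bs p q → letters o bs ≡ p ++ q →
  ∃₂ λ bs₁ bs₂ → bs ≡ bs₁ ++ bs₂ × p ≡ letters o bs₁ × q ≡ letters (length (flatten bs₁) + o) bs₂
letters-++⁻ o bs [] q e = [] , bs , refl , refl , sym e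
letters-++⁻ o ((D , c) ∷ bs) (x ∷ p) q e with letters-++⁻ _ bs p q (∷-injectiveʳ e)
... | bs₁ , bs₂ , refl , refl , refl =
  (D , c) ∷ bs₁ , bs₂ , refl , cong (_∷ letters _ bs₁) (sym (∷-injectiveˡ e)) ,
  cong (λ z → letters z bs₂) (letters-offset D c bs₁ o)

letters-∷⁻ : ∀ o bs {i c m} → letters o bs ≡ (i , c) ∷ m →
  ∃₂ λ D bs′ → bs ≡ (D , c) ∷ bs′ × i ≡ length D + o × m ≡ letters (suc (length D + o)) bs′
letters-∷⁻ o ((D , c) ∷ bs) refl = D , bs , refl , refl , refl

letters-[]⁻ : ∀ o bs → letters o bs ≡ [] → bs ≡ []
letters-[]⁻ o [] _ = refl

-- l lists the unmatched letters of w with their positions, and the letters of w strictly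
-- between two cyclically consecutive ones form a Dyck word; the gap that wraps around the
-- end of w is  back ++ front.
record DyckGaps (w : Word) (l : Letters) : Set where
  constructor dyckGaps
  field
    front   : Word
    blocks  : List Block
    back    : Word
    word≡   : w ≡ front ++ flattenOnto blocks back
    letters≡ : l ≡ letters (length front) blocks
    gaps    : All (Dyck ∘ proj₁) blocks
    wrapGap : Dyck (back ++ front)

prependGap : Word → List Block → Word → List Block × Word
prependGap M [] e = [] , M ++ e
prependGap M ((D , c) ∷ bs) e = (M ++ D , c) ∷ bs , e

module _ (M : Word) where

  prependGap-flattenOnto : ∀ bs e → uncurry flattenOnto (prependGap M bs e) ≡ M ++ flattenOnto bs e
  prependGap-flattenOnto [] e = refl
  prependGap-flattenOnto ((D , c) ∷ bs) e = ++-assoc M D _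

  prependGap-letters : ∀ o bs e → letters o (proj₁ (prependGap M bs e)) ≡ letters (length M + o) bs
  prependGap-letters o [] e = refl
  prependGap-letters o ((D , c) ∷ bs) e = cong (λ z → (z , c) ∷ letters (suc z) bs) (begin
    length (M ++ D) + o     ≡⟨ cong (_+ o) (length-++ M) ⟩
    length M + length D + o ≡⟨ arith (length M) (length D) o ⟩
    length D + (length M + o) ∎)
    where
    arith : ∀ m d o → m + d + o ≡ d + (m + o)
    arith = solve-∀

  prependGap-gaps : Dyck M → ∀ {bs} e → All (Dyck ∘ proj₁) bs → All (Dyck ∘ proj₁) (proj₁ (prependGap M bs e))
  prependGap-gaps dM e [] = []
  prependGap-gaps dM e (dD ∷ ds) = Dyck-++ dM dD ∷ ds

  prependGap-wrapGap : Dyck M → ∀ bs {e} front → Dyck (e ++ front) → Dyck (proj₂ (prependGap M bs e) ++ front)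
  prependGap-wrapGap dM [] {e} front d = subst Dyck (sym (++-assoc M e front)) (Dyck-++ dM d)
  prependGap-wrapGap dM ((D , c) ∷ bs) front d = d

-- The matched pair and its gaps become part of the gap before the next unmatched letter.
DyckGaps-adjacent : ∀ {w l l′} → AdjacentRemoved l l′ → DyckGaps w l → DyckGaps w l′
DyckGaps-adjacent {w} (adjacentRemoved p i j r refl refl) (dyckGaps F bs B w≡ l≡ gs wg)
  with letters-++⁻ (length F) bs p _ (sym l≡)
... | bs₁ , bs₂ , refl , refl , pr≡ with letters-++⁻ _ bs₂ ((i , false) ∷ (j , true) ∷ []) r (sym pr≡)
... | pair , bs₃ , refl , pair≡ , r≡ with letters-∷⁻ _ pair (sym pair≡)
... | D , rest , refl , _ , rest≡ with letters-∷⁻ _ rest (sym rest≡)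
... | D₂ , rest′ , refl , _ , rest′≡ with letters-[]⁻ _ rest′ (sym rest′≡)
... | refl with ++⁻ bs₁ gs
... | gs₁ , dD ∷ dD₂ ∷ gs₃ =
  dyckGaps F (bs₁ ++ proj₁ t) (proj₂ t) word≡ letters≡ (++⁺ gs₁ (prependGap-gaps M dM B gs₃))
    (prependGap-wrapGap M dM bs₃ F wg)
  where
  M = flatten pair
  t = prependGap M bs₃ B
  o = length (flatten bs₁) + length F
  dM : Dyck M
  dM = Dyck-++ dD (Dyck-nest dD₂)
  word≡ : w ≡ F ++ flattenOnto (bs₁ ++ proj₁ t) (proj₂ t)
  word≡ = begin
    w                                                  ≡⟨ w≡ ⟩
    F ++ flattenOnto (bs₁ ++ pair ++ bs₃) B            ≡⟨ cong (F ++_) (flattenOnto-++ bs₁ _ B) ⟩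
    F ++ flattenOnto bs₁ (flattenOnto (pair ++ bs₃) B) ≡⟨ cong (λ z → F ++ flattenOnto bs₁ z) (flattenOnto-pair B) ⟩
    F ++ flattenOnto bs₁ (M ++ flattenOnto bs₃ B)      ≡⟨ cong (λ z → F ++ flattenOnto bs₁ z) (prependGap-flattenOnto M bs₃ B) ⟨
    F ++ flattenOnto bs₁ (uncurry flattenOnto t)       ≡⟨ cong (F ++_) (flattenOnto-++ bs₁ _ _) ⟨
    F ++ flattenOnto (bs₁ ++ proj₁ t) (proj₂ t)        ∎
    where
    flattenOnto-pair : ∀ e → flattenOnto (pair ++ bs₃) e ≡ M ++ flattenOnto bs₃ e
    flattenOnto-pair e = sym (trans (++-assoc D _ _) (cong (λ z → D ++ false ∷ z) (++-assoc D₂ _ _)))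
  letters≡ : letters (length F) bs₁ ++ r ≡ letters (length F) (bs₁ ++ proj₁ t)
  letters≡ = begin
    letters (length F) bs₁ ++ r                      ≡⟨ cong (letters (length F) bs₁ ++_) r≡ ⟩
    letters (length F) bs₁ ++ letters (length M + o) bs₃ ≡⟨ cong (letters (length F) bs₁ ++_) (prependGap-letters M o bs₃ B) ⟨
    letters (length F) bs₁ ++ letters o (proj₁ t)    ≡⟨ letters-++ (length F) bs₁ _ ⟨
    letters (length F) (bs₁ ++ proj₁ t)              ∎

-- The first unmatched letter, a 1, and the last one, a 0, match across the end of w: their
-- gaps join the wrap-around gap.
DyckGaps-aroundEnd : ∀ {w i m j} → DyckGaps w ((i , true) ∷ m ++ [ (j , false) ]) → DyckGaps w m
DyckGaps-aroundEnd {w} {i} {m} {j} (dyckGaps F bs B w≡ l≡ gs wg) with letters-∷⁻ (length F) bs (sym l≡)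
... | D₁ , bs′ , refl , _ , m≡ with letters-++⁻ _ bs′ m [ (j , false) ] (sym m≡)
... | bs₁ , bs₂ , refl , refl , last≡ with letters-∷⁻ _ bs₂ (sym last≡)
... | D , rest , refl , _ , rest≡ with letters-[]⁻ _ rest (sym rest≡)
... | refl with gs
... | dD₁ ∷ gs′ with ++⁻ bs₁ gs′
... | gs₁ , dD ∷ [] = dyckGaps F′ bs₁ B′ word≡ letters≡ gs₁ wrapGap
  where
  F′ = F ++ D₁ ++ [ true ]
  B′ = D ++ false ∷ B
  word≡ : w ≡ F′ ++ flattenOnto bs₁ B′
  word≡ = begin
    w                                             ≡⟨ w≡ ⟩
    F ++ D₁ ++ true ∷ flattenOnto (bs₁ ++ _) B    ≡⟨ cong (λ z → F ++ D₁ ++ true ∷ z) (flattenOnto-++ bs₁ _ B) ⟩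
    F ++ D₁ ++ [ true ] ++ flattenOnto bs₁ B′     ≡⟨ cong (F ++_) (++-assoc D₁ [ true ] _) ⟨
    F ++ (D₁ ++ [ true ]) ++ flattenOnto bs₁ B′   ≡⟨ ++-assoc F _ _ ⟨
    F′ ++ flattenOnto bs₁ B′                      ∎
  letters≡ : letters (suc (length D₁ + length F)) bs₁ ≡ letters (length F′) bs₁
  letters≡ = cong (λ z → letters z bs₁) (begin
    suc (length D₁ + length F)    ≡⟨ arith (length F) (length D₁) ⟩
    length F + (length D₁ + 1)    ≡⟨ cong (length F +_) (length-++ D₁) ⟨
    length F + length (D₁ ++ [ true ]) ≡⟨ length-++ F ⟨
    length F′                     ∎)
    where
    arith : ∀ f d → suc (d + f) ≡ f + (d + 1)
    arith = solve-∀
  wrapGap : Dyck (B′ ++ F′)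
  wrapGap = subst Dyck (sym (begin
    (D ++ false ∷ B) ++ F ++ D₁ ++ [ true ]      ≡⟨ ++-assoc D _ _ ⟩
    D ++ false ∷ B ++ F ++ D₁ ++ [ true ]        ≡⟨ cong (λ z → D ++ false ∷ z) (++-assoc B F _) ⟨
    D ++ false ∷ (B ++ F) ++ D₁ ++ [ true ]      ≡⟨ cong (λ z → D ++ false ∷ z) (++-assoc (B ++ F) D₁ _) ⟨
    D ++ false ∷ ((B ++ F) ++ D₁) ++ [ true ]    ∎))
    (Dyck-++ dD (Dyck-nest (Dyck-++ wg dD₁)))

DyckGaps-step : ∀ {w l l′} → MatchedStep l l′ → DyckGaps w l → DyckGaps w l′
DyckGaps-step (adjacent a) g = DyckGaps-adjacent a g
DyckGaps-step (aroundEnd i j refl) g = DyckGaps-aroundEnd g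

DyckGaps-single : ∀ {w i} → DyckGaps w ((i , true) ∷ []) →
  ∃₂ λ u v → w ≡ u ++ true ∷ v × i ≡ length u × Dyck (v ++ u)
DyckGaps-single {w} (dyckGaps F bs B w≡ l≡ gs wg) with letters-∷⁻ (length F) bs (sym l≡)
... | D , rest , refl , i≡ , rest≡ with letters-[]⁻ _ rest (sym rest≡) | gs
... | refl | dD ∷ [] =
  F ++ D , B , trans w≡ (sym (++-assoc F D _)) ,
  trans i≡ (trans (+-comm (length D) (length F)) (sym (length-++ F))) ,
  subst Dyck (++-assoc B F D) (Dyck-++ wg dD)

singletons : Word → List Block
singletons = map ([] ,_)

indexed-singletons : ∀ w → indexed w ≡ letters 0 (singletons w)
indexed-singletons w = go id 0 w (λ i → sym (+-identityʳ i))
  where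
  go : ∀ (f : ℕ → ℕ) o w → (∀ i → f i ≡ i + o) → zip (applyUpTo f (length w)) w ≡ letters o (singletons w)
  go f o [] _ = refl
  go f o (c ∷ w) f≡ = cong₂ _∷_ (cong (_, c) (f≡ 0))
    (go (f ∘ suc) (suc o) w (λ i → trans (f≡ (suc i)) (sym (+-suc i o))))

DyckGaps-indexed : ∀ w → DyckGaps w (indexed w)
DyckGaps-indexed w = dyckGaps [] (singletons w) [] (sym (flatten-singletons w)) (indexed-singletons w)
  (map⁺ (universal (λ _ → Dyck-[]) w)) Dyck-[]
  where
  flatten-singletons : ∀ w → flatten (singletons w) ≡ w
  flatten-singletons [] = refl
  flatten-singletons (c ∷ w) = cong (c ∷_) (flatten-singletons w)

bits-indexed : ∀ w → bits (indexed w) ≡ w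
bits-indexed w = trans (cong bits (indexed-singletons w)) (trans (bits-letters 0 (singletons w)) (trans (sym (map-∘ w)) (map-id w)))
  where
  bits-letters : ∀ o bs → bits (letters o bs) ≡ map proj₂ bs
  bits-letters o [] = refl
  bits-letters o ((D , c) ∷ bs) = cong (c ∷_) (bits-letters _ bs)

single-unmatched-one : ∀ w → rank w ≡ suc (zeros w) →
  ∃₂ λ u v → w ≡ u ++ true ∷ v × unmatched w ≡ (length u , true) ∷ [] × Dyck (v ++ u)
single-unmatched-one w excess
  with matchLoop-invariant (λ l → DyckGaps w l × Excess l)
         (λ s (g , e) → DyckGaps-step s g , Excess-step s e) (length w) (indexed w)
         (≤-reflexive (trans (sym (length-map proj₂ (indexed w))) (cong length (bits-indexed w))))
         (DyckGaps-indexed w , subst (λ z → rank z ≡ suc (zeros z)) (sym (bits-indexed w)) excess)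
... | (gaps , ex) , stuck with uncurry (stuck-excess (unmatched w)) (matchStep-nothing (unmatched w) stuck) ex
... | i , unmatched≡ with DyckGaps-single (subst (DyckGaps w) unmatched≡ gaps)
... | u , v , w≡ , refl , dyck = u , v , w≡ , unmatched≡ , dyck

setZero-length : ∀ u c v → setZero (length u) (u ++ c ∷ v) ≡ u ++ false ∷ v
setZero-length [] c v = refl
setZero-length (a ∷ u) c v = cong (a ∷_) (setZero-length u c v)

φ-single : ∀ x {i} → unmatched (lyndon x) ≡ (i , true) ∷ [] → φ x ≡ setZero i (lyndon x)
φ-single x e rewrite e = refl

lyndon-excess : ∀ x → rank x ≡ suc (zeros x) → rank (lyndon x) ≡ suc (zeros (lyndon x))
lyndon-excess x excess = begin
  rank (lyndon x)         ≡⟨ ∼-additive rank rank-++ (∼-lyndon x) ⟩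
  rank x                  ≡⟨ excess ⟩
  suc (zeros x)           ≡⟨ cong suc (∼-additive zeros zeros-++ (∼-lyndon x)) ⟨
  suc (zeros (lyndon x))  ∎

-- Opaque, so that later uses do not make Agda unfold the parenthesization of lyndon x.
opaque
  φ-cut : ∀ x → rank x ≡ suc (zeros x) →
    ∃₂ λ u v → lyndon x ≡ u ++ true ∷ v × φ x ≡ u ++ false ∷ v ×
               unmatched (lyndon x) ≡ (length u , true) ∷ [] × Dyck (v ++ u)
  φ-cut x excess =
    let u , v , lx≡ , unmatched≡ , dyck = single-unmatched-one (lyndon x) (lyndon-excess x excess)
        φx≡ = trans (φ-single x unmatched≡) (trans (cong (setZero (length u)) lx≡) (setZero-length u true v))
    in u , v , lx≡ , φx≡ , unmatched≡ , dyck

φ-rotations : ∀ x → rank x ≡ suc (zeros x) → ∃ λ D → Dyck D × x ∼ (true ∷ D) × φ x ∼ (false ∷ D)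
φ-rotations x excess =
  let u , v , lx≡ , φx≡ , _ , dyck = φ-cut x excess in
  v ++ u , dyck , ∼-trans (∼-lyndon x) (subst (λ z → z ∼ (true ∷ v ++ u)) (sym lx≡) (++-∼ u (true ∷ v))) ,
  subst (λ z → z ∼ (false ∷ v ++ u)) (sym φx≡) (++-∼ u (false ∷ v))

φ-injective : ∀ {x y} → rank x ≡ suc (zeros x) → rank y ≡ suc (zeros y) → φ x ∼ φ y → x ∼ y
φ-injective {x} {y} ex ey φx∼φy =
  let D , dD , x∼ , φx∼ = φ-rotations x ex
      D′ , dD′ , y∼ , φy∼ = φ-rotations y ey
      D≡D′ = false∷Dyck-∼-injective dD dD′ (∼-trans (∼-sym φx∼) (∼-trans φx∼φy φy∼))
  in ∼-trans x∼ (subst (λ z → (true ∷ z) ∼ y) (sym D≡D′) (∼-sym y∼))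

rank-φ : ∀ x → rank x ≡ suc (zeros x) → rank (φ x) ≡ zeros x
rank-φ x excess =
  let u , v , lx≡ , φx≡ , _ = φ-cut x excess in
  suc-injective (begin
    suc (rank (φ x))             ≡⟨ cong (suc ∘ rank) φx≡ ⟩
    suc (rank (u ++ false ∷ v))  ≡⟨ cong suc (rank-++ u _) ⟩
    suc (rank u + rank v)        ≡⟨ +-suc (rank u) (rank v) ⟨
    rank u + rank (true ∷ v)     ≡⟨ rank-++ u _ ⟨
    rank (u ++ true ∷ v)         ≡⟨ cong rank lx≡ ⟨
    rank (lyndon x)              ≡⟨ lyndon-excess x excess ⟩
    suc (zeros (lyndon x))       ≡⟨ cong suc (∼-additive zeros zeros-++ (∼-lyndon x)) ⟩
    suc (zeros x)                ∎)

zeros-of-odd : ∀ x k → length x ≡ 2 * k + 1 → rank x ≡ suc k → zeros x ≡ k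
zeros-of-odd x k len rx = +-cancelˡ-≡ (suc k) (zeros x) k (begin
  suc k + zeros x      ≡⟨ cong (_+ zeros x) rx ⟨
  rank x + zeros x     ≡⟨ length≡rank+zeros x ⟨
  length x             ≡⟨ len ⟩
  2 * k + 1            ≡⟨ arith k ⟩
  suc k + k            ∎)
  where
  arith : ∀ k → 2 * k + 1 ≡ suc k + k
  arith = solve-∀

mainTheorem5 : (n k : ℕ) → n ≡ 2 * k + 1 →
    ((x y : Word) → length x ≡ n → length y ≡ n →
      rank x ≡ suc k → rank y ≡ suc k → φ x ∼ φ y → x ∼ y)
    × ((x : Word) → length x ≡ n → rank x ≡ suc k →
      (map proj₂ (unmatched x) ≡ true ∷ [])
      × (map proj₂ (unmatched (lyndon x)) ≡ true ∷ [])
      × (rank (φ x) ≡ k))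
mainTheorem5 n k refl =
  (λ x y lx ly rx ry → φ-injective (excess x lx rx) (excess y ly ry)) ,
  λ x lx rx →
    let _ , _ , _ , unmatched≡ , _ = single-unmatched-one x (excess x lx rx)
        _ , _ , _ , _ , lyndon-unmatched≡ , _ = φ-cut x (excess x lx rx)
    in cong bits unmatched≡ , cong bits lyndon-unmatched≡ , trans (rank-φ x (excess x lx rx)) (zeros-of-odd x k lx rx)
  where
  excess : ∀ x → length x ≡ 2 * k + 1 → rank x ≡ suc k → rank x ≡ suc (zeros x)
  excess x lx rx = trans rx (cong suc (sym (zeros-of-odd x k lx rx)))
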